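{- For every integer $r\geqslant 1$, the set $S^{(r)}$ is a zero forcing set for the butterfly network $\mathrm{BF}(r)$.
   Context: $(J_n)$ is the Jacobsthal sequence: $J_0=0$, $J_1=1$, $J_n=J_{n-1}+2J_{n-2}$. The butterfly network $\mathrm{BF}(r)$ has vertex set $\bigcup_{i=0}^r V_i$ with $V_i=\{(x,i): x\in\{0,\dots,2^r-1\}\}$, each $x$ identified with the binary vector $(x_1,\dots,x_r)$ with $x=\sum_j x_j2^{j-1}$; edges join $(x,i-1)$ and $(y,i)$ for $1\leqslant i\leqslant r$ and $y\in\{x,x+e_i\}$ (addition modulo 2, $e_i$ the $i$-th unit vector). $S^{(r)}=S_0\cup\cdots\cup S_r$ with $S_i=\{(x,i): 2^{i+1}\ell\leqslant x\leqslant 2^{i+1}\ell+J_{i+1}-1 \text{ for some integer }\ell\}$ for $i=0,\dots,r-1$ and $S_r=\{(x,r): 0\leqslant x\leqslant J_{r+1}-1\}$. Zero forcing: starting with a set $S$ of colored vertices, an uncolored vertex becomes colored if it is the only uncolored neighbor of some colored vertex; $S$ is zero forcing if repeatedly applying this rule colors every vertex. -}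

module Defs where

open import Data.Nat using (ℕ; zero; suc; _+_; _*_; _∸_; _^_; _≤_; _<_; _/_; _%_)
open import Data.Nat.Properties using (_≟_)
open import Data.Fin using (Fin; toℕ)
open import Data.Product using (_×_; Σ; _,_)
open import Data.Sum using (_⊎_)
open import Data.Bool using (if_then_else_)
open import Relation.Nullary using (¬_)
open import Relation.Nullary.Decidable using (⌊_⌋)
open import Relation.Binary.PropositionalEquality using (_≡_)

J : ℕ → ℕ
J zero = 0
J (suc zero) = 1
J (suc (suc n)) = J (suc n) + 2 * J n

data Forced {V : Set} (Adj : V → V → Set) (S : V → Set) : V → Set where
  init  : ∀ {v} → S v → Forced Adj S v
  force : ∀ {v} (u : V) → Forced Adj S u → Adj u v →
          (∀ w → Adj u w → ¬ (w ≡ v) → Forced Adj S w) →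
          Forced Adj S v

IsZeroForcing : {V : Set} (Adj : V → V → Set) (S : V → Set) → Set
IsZeroForcing {V} Adj S = ∀ (v : V) → Forced Adj S v

-- Binary digits.  bit x j = x_{j+1}, the coefficient of 2^j in x.

bit : ℕ → ℕ → ℕ
bit x zero    = x % 2
bit x (suc j) = bit (x / 2) j

-- flipBit x j = x + e_{j+1} (mod 2 coordinatewise): toggle the
-- coefficient of 2^j.
flipBit : ℕ → ℕ → ℕ
flipBit x j = if ⌊ bit x j ≟ 0 ⌋ then x + 2 ^ j else x ∸ 2 ^ j

BFVertex : ℕ → Set
BFVertex r = Fin (2 ^ r) × Fin (suc r)

-- BFEdge r (x , a) (y , b) : a = i - 1, b = i (1 ≤ i ≤ r) and
-- y ∈ {x, x + e_i}; here e_i toggles the coefficient of 2^(i-1) = 2^a.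
BFEdge : (r : ℕ) → BFVertex r → BFVertex r → Set
BFEdge r (x , a) (y , b) =
  (suc (toℕ a) ≡ toℕ b) × ((toℕ y ≡ toℕ x) ⊎ (toℕ y ≡ flipBit (toℕ x) (toℕ a)))

BFAdj : (r : ℕ) → BFVertex r → BFVertex r → Set
BFAdj r u v = BFEdge r u v ⊎ BFEdge r v u

Sr : (r : ℕ) → BFVertex r → Set
Sr r (x , i) =
  (toℕ i < r × Σ ℕ (λ ℓ → (2 ^ (toℕ i + 1) * ℓ ≤ toℕ x) ×
                          (toℕ x ≤ 2 ^ (toℕ i + 1) * ℓ + J (toℕ i + 1) ∸ 1)))
  ⊎ (toℕ i ≡ r × toℕ x ≤ J (r + 1) ∸ 1)

module Submission where

-- Let A(n) (SmallColoured n) say that every vertex (x, n) with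
-- x mod 2^n < J(n+1) is forced.
-- A(r) holds since those vertices lie in S_r, and A(m) follows from A(m+1)
-- and A(m+2): if bit m of x is 0 then (x, m) lies in S_m; otherwise
-- x' = x + e_{m+1} has x' mod 2^{m+1} = x mod 2^m, so (x', m+1) is forced by
-- A(m+1), its upper neighbours are forced by A(m+2) because
-- J(m+1) + 2^{m+1} = J(m+3), its straight lower neighbour (x', m) lies in S_m,
-- and hence it forces (x, m).  Knowing A at every level, the levels are then
-- coloured bottom-up: (x, m+1) is covered by A(m+1) when bit m of x is 0
-- (as 2^m ≤ J(m+2)), and otherwise it is the last uncoloured neighbour of
-- (x + e_{m+1}, m).

open import Defs
open import Data.Nat
open import Data.Nat.Properties
open import Data.Nat.DivMod
open import Data.Nat.Divisibility using (divides)
open import Data.Nat.Solver using (module +-*-Solver)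
open +-*-Solver using (solve; _:=_; _:+_; _:*_; con)
open import Data.Fin using (Fin; toℕ; fromℕ<)
open import Data.Fin.Properties using (toℕ-injective; toℕ<n; toℕ-fromℕ<)
open import Data.Product using (_×_; _,_; proj₁)
open import Data.Sum using (_⊎_; inj₁; inj₂)
open import Data.Empty using (⊥-elim)
open import Relation.Nullary using (¬_; yes; no)
open import Relation.Binary.PropositionalEquality hiding (J)
open ≡-Reasoning

infixl 7 _div2^_ _mod2^_

_div2^_ _mod2^_ : ℕ → ℕ → ℕ
x div2^ n = _/_ x (2 ^ n) {{m^n≢0 2 n}}
x mod2^ n = _%_ x (2 ^ n) {{m^n≢0 2 n}}

bit≡div2^%2 : ∀ x m → bit x m ≡ x div2^ m % 2
bit≡div2^%2 x zero    = cong (_% 2) (sym (n/1≡n x))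
bit≡div2^%2 x (suc m) =
  trans (bit≡div2^%2 (x / 2) m) (cong (_% 2) (m/n/o≡m/[n*o] x 2 (2 ^ m)))
  where instance _ = m^n≢0 2 m
                 _ = m^n≢0 2 (suc m)

bit≡0⊎bit≡1 : ∀ x m → bit x m ≡ 0 ⊎ bit x m ≡ 1
bit≡0⊎bit≡1 x m with x div2^ m % 2 | m%n<n (x div2^ m) 2 | bit≡div2^%2 x m
... | 0 | _ | e = inj₁ e
... | 1 | _ | e = inj₂ e
... | suc (suc _) | s≤s (s≤s ()) | _

mod2^-suc : ∀ x m → x mod2^ suc m ≡ x mod2^ m + bit x m * 2 ^ m
mod2^-suc x m = begin
  x % (2 * 2 ^ m)
    ≡⟨ m≡m%n+[m/n]*n (x % (2 * 2 ^ m)) (2 ^ m) ⟩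
  x % (2 * 2 ^ m) % 2 ^ m + x % (2 * 2 ^ m) / 2 ^ m * 2 ^ m
    ≡⟨ cong₂ (λ a b → a + b * 2 ^ m)
         (m∣n⇒o%n%m≡o%m (2 ^ m) (2 * 2 ^ m) x (divides 2 refl))
         (trans (m%[n*o]/o≡m/o%n x 2 (2 ^ m)) (sym (bit≡div2^%2 x m))) ⟩
  x % 2 ^ m + bit x m * 2 ^ m ∎
  where instance _ = m^n≢0 2 m
                 _ = m^n≢0 2 (suc m)

bit≡0⇒mod2^-suc≡mod2^ : ∀ x m → bit x m ≡ 0 → x mod2^ suc m ≡ x mod2^ m
bit≡0⇒mod2^-suc≡mod2^ x m b≡0 = begin
  x mod2^ suc m               ≡⟨ mod2^-suc x m ⟩
  x mod2^ m + bit x m * 2 ^ m ≡⟨ cong (λ b → x mod2^ m + b * 2 ^ m) b≡0 ⟩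
  x mod2^ m + 0               ≡⟨ +-identityʳ _ ⟩
  x mod2^ m                   ∎

mod2^-suc≤ : ∀ x m → x mod2^ suc m ≤ x mod2^ m + 2 ^ m
mod2^-suc≤ x m = subst (_≤ x mod2^ m + 2 ^ m) (sym (mod2^-suc x m))
  (+-monoʳ-≤ (x mod2^ m) (subst (bit x m * 2 ^ m ≤_) (*-identityˡ (2 ^ m))
    (*-monoˡ-≤ (2 ^ m) bit≤1)))
  where
  bit≤1 : bit x m ≤ 1
  bit≤1 with bit≡0⊎bit≡1 x m
  ... | inj₁ b≡0 = subst (_≤ 1) (sym b≡0) z≤n
  ... | inj₂ b≡1 = subst (_≤ 1) (sym b≡1) ≤-refl

bit≡1⇒2^≤ : ∀ x m → bit x m ≡ 1 → 2 ^ m ≤ x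
bit≡1⇒2^≤ x m b≡1 = m/n≢0⇒n≤m λ x/2^m≡0 →
  0≢1+n (trans (sym (cong (_% 2) x/2^m≡0)) (trans (sym (bit≡div2^%2 x m)) b≡1))
  where instance _ = m^n≢0 2 m

bit[+2^]≡1 : ∀ x m → bit x m ≡ 0 → bit (x + 2 ^ m) m ≡ 1
bit[+2^]≡1 x m b≡0 = begin
  bit (x + 2 ^ m) m                       ≡⟨ bit≡div2^%2 (x + 2 ^ m) m ⟩
  (x + 2 ^ m) / 2 ^ m % 2                 ≡⟨ cong (_% 2) (m/n≡1+[m∸n]/n (m≤n+m (2 ^ m) x)) ⟩
  (1 + (x + 2 ^ m ∸ 2 ^ m) / 2 ^ m) % 2   ≡⟨ cong (λ z → (1 + z / 2 ^ m) % 2) (m+n∸n≡m x (2 ^ m)) ⟩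
  (1 + x / 2 ^ m) % 2                     ≡⟨ %-distribˡ-+ 1 (x / 2 ^ m) 2 ⟩
  (1 + x / 2 ^ m % 2) % 2                 ≡⟨ cong (λ z → (1 + z) % 2)
                                               (trans (sym (bit≡div2^%2 x m)) b≡0) ⟩
  1                                       ∎
  where instance _ = m^n≢0 2 m

bit[∸2^]≡0 : ∀ x m → bit x m ≡ 1 → bit (x ∸ 2 ^ m) m ≡ 0
bit[∸2^]≡0 x m b≡1 = begin
  bit (x ∸ 2 ^ m) m            ≡⟨ bit≡div2^%2 (x ∸ 2 ^ m) m ⟩
  (x ∸ 2 ^ m) / 2 ^ m % 2      ≡⟨ cong (_% 2) ([m∸n]/n≡m/n∸1 x (2 ^ m)) ⟩
  pred d % 2                   ≡⟨ cong (λ z → pred z % 2) (m≡m%n+[m/n]*n d 2) ⟩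
  pred (d % 2 + d / 2 * 2) % 2 ≡⟨ cong (λ z → pred (z + d / 2 * 2) % 2)
                                     (trans (sym (bit≡div2^%2 x m)) b≡1) ⟩
  d / 2 * 2 % 2                ≡⟨ m*n%n≡0 (d / 2) 2 ⟩
  0                            ∎
  where
  instance _ = m^n≢0 2 m
  d = x / 2 ^ m

flipBit-bit≡0 : ∀ x m → bit x m ≡ 0 → flipBit x m ≡ x + 2 ^ m
flipBit-bit≡0 x m b≡0 rewrite b≡0 = refl

flipBit-bit≡1 : ∀ x m → bit x m ≡ 1 → flipBit x m ≡ x ∸ 2 ^ m
flipBit-bit≡1 x m b≡1 rewrite b≡1 = refl

flipBit-involutive : ∀ x m → flipBit (flipBit x m) m ≡ x
flipBit-involutive x m with bit≡0⊎bit≡1 x m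
... | inj₁ b≡0 = begin
  flipBit (flipBit x m) m  ≡⟨ cong (λ y → flipBit y m) (flipBit-bit≡0 x m b≡0) ⟩
  flipBit (x + 2 ^ m) m    ≡⟨ flipBit-bit≡1 (x + 2 ^ m) m (bit[+2^]≡1 x m b≡0) ⟩
  x + 2 ^ m ∸ 2 ^ m        ≡⟨ m+n∸n≡m x (2 ^ m) ⟩
  x                        ∎
... | inj₂ b≡1 = begin
  flipBit (flipBit x m) m  ≡⟨ cong (λ y → flipBit y m) (flipBit-bit≡1 x m b≡1) ⟩
  flipBit (x ∸ 2 ^ m) m    ≡⟨ flipBit-bit≡0 (x ∸ 2 ^ m) m (bit[∸2^]≡0 x m b≡1) ⟩
  x ∸ 2 ^ m + 2 ^ m        ≡⟨ m∸n+n≡m (bit≡1⇒2^≤ x m b≡1) ⟩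
  x                        ∎

flipBit-mod2^ : ∀ x m → flipBit x m mod2^ m ≡ x mod2^ m
flipBit-mod2^ x m with bit≡0⊎bit≡1 x m
... | inj₁ b≡0 = trans (cong (_% 2 ^ m) (flipBit-bit≡0 x m b≡0)) ([m+n]%n≡m%n x (2 ^ m))
  where instance _ = m^n≢0 2 m
... | inj₂ b≡1 = trans (cong (_% 2 ^ m) (flipBit-bit≡1 x m b≡1))
                      (m≤n⇒[n∸m]%m≡n%m (bit≡1⇒2^≤ x m b≡1))
  where instance _ = m^n≢0 2 m

bit≡1⇒flipBit≤ : ∀ x m → bit x m ≡ 1 → flipBit x m ≤ x
bit≡1⇒flipBit≤ x m b≡1 = subst (_≤ x) (sym (flipBit-bit≡1 x m b≡1)) (m∸n≤m x (2 ^ m))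

bit≡1⇒bit-flipBit≡0 : ∀ x m → bit x m ≡ 1 → bit (flipBit x m) m ≡ 0
bit≡1⇒bit-flipBit≡0 x m b≡1 =
  subst (λ y → bit y m ≡ 0) (sym (flipBit-bit≡1 x m b≡1)) (bit[∸2^]≡0 x m b≡1)

bit≡1⇒flipBit-mod2^-suc : ∀ x m → bit x m ≡ 1 → flipBit x m mod2^ suc m ≡ x mod2^ m
bit≡1⇒flipBit-mod2^-suc x m b≡1 = begin
  flipBit x m mod2^ suc m
    ≡⟨ bit≡0⇒mod2^-suc≡mod2^ (flipBit x m) m (bit≡1⇒bit-flipBit≡0 x m b≡1) ⟩
  flipBit x m mod2^ m     ≡⟨ flipBit-mod2^ x m ⟩
  x mod2^ m               ∎

J+J-suc≡2^ : ∀ n → J n + J (suc n) ≡ 2 ^ n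
J+J-suc≡2^ zero    = refl
J+J-suc≡2^ (suc n) = begin
  J (suc n) + (J (suc n) + 2 * J n)
    ≡⟨ solve 2 (λ a b → b :+ (b :+ con 2 :* a) := con 2 :* (a :+ b)) refl (J n) (J (suc n)) ⟩
  2 * (J n + J (suc n))
    ≡⟨ cong (2 *_) (J+J-suc≡2^ n) ⟩
  2 * 2 ^ n
    ∎

J-suc-suc≡2^+J : ∀ n → J (suc (suc n)) ≡ 2 ^ n + J n
J-suc-suc≡2^+J n = begin
  J (suc n) + 2 * J n
    ≡⟨ solve 2 (λ a b → b :+ con 2 :* a := (a :+ b) :+ a) refl (J n) (J (suc n)) ⟩
  (J n + J (suc n)) + J n
    ≡⟨ cong (_+ J n) (J+J-suc≡2^ n) ⟩
  2 ^ n + J n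
    ∎

2^≤J-suc-suc : ∀ n → 2 ^ n ≤ J (suc (suc n))
2^≤J-suc-suc n = subst (2 ^ n ≤_) (sym (J-suc-suc≡2^+J n)) (m≤m+n (2 ^ n) (J n))

mod2^<J⇒mod2^-suc<J-suc-suc : ∀ x n → x mod2^ n < J n → x mod2^ suc n < J (suc (suc n))
mod2^<J⇒mod2^-suc<J-suc-suc x n x%<J = ≤-<-trans (mod2^-suc≤ x n)
  (subst (x mod2^ n + 2 ^ n <_) (trans (+-comm (J n) (2 ^ n)) (sym (J-suc-suc≡2^+J n)))
    (+-monoˡ-< (2 ^ n) x%<J))

bit≡0⇒mod2^-suc<J-suc-suc : ∀ x n → bit x n ≡ 0 → x mod2^ suc n < J (suc (suc n))
bit≡0⇒mod2^-suc<J-suc-suc x n b≡0 =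
  subst (_< J (suc (suc n))) (sym (bit≡0⇒mod2^-suc≡mod2^ x n b≡0))
    (<-≤-trans (m%n<n x (2 ^ n)) (2^≤J-suc-suc n))
  where instance _ = m^n≢0 2 n

%<⇒initial-segment : ∀ x n j .{{_ : NonZero n}} → x % n < j →
                     n * (x / n) ≤ x × x ≤ n * (x / n) + j ∸ 1
%<⇒initial-segment x n j x%n<j = block≤x , ∸-monoˡ-≤ 1 x<block+j
  where
  x≡ : x ≡ x % n + n * (x / n)
  x≡ = trans (m≡m%n+[m/n]*n x n) (cong (x % n +_) (*-comm (x / n) n))
  block≤x : n * (x / n) ≤ x
  block≤x = subst (n * (x / n) ≤_) (sym x≡) (m≤n+m (n * (x / n)) (x % n))
  x<block+j : suc x ≤ n * (x / n) + j
  x<block+j = subst (λ z → suc z ≤ n * (x / n) + j) (sym x≡)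
    (subst (suc (x % n) + n * (x / n) ≤_) (+-comm j (n * (x / n)))
      (+-monoˡ-≤ (n * (x / n)) x%n<j))

data Adjℕ (x i : ℕ) : ℕ → ℕ → Set where
  up-straight   : Adjℕ x i x (suc i)
  up-cross      : Adjℕ x i (flipBit x i) (suc i)
  down-straight : ∀ {k} → suc k ≡ i → Adjℕ x i x k
  down-cross    : ∀ {k} → suc k ≡ i → Adjℕ x i (flipBit x k) k

module Forcing (r : ℕ) where

  -- Coordinates outside BF(r) count as coloured, vacuously.
  Coloured : ℕ → ℕ → Set
  Coloured x i = ∀ {a : Fin (2 ^ r)} {l : Fin (suc r)} → toℕ a ≡ x → toℕ l ≡ i →
                 Forced (BFAdj r) (Sr r) (a , l)

  Coloured-beyond : ∀ {x k} → r < k → Coloured x k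
  Coloured-beyond r<k {l = l} _ refl =
    ⊥-elim (<-irrefl refl (<-≤-trans r<k (≤-pred (toℕ<n l))))

  BFAdj⇒Adjℕ : ∀ {a b l m} → BFAdj r (a , l) (b , m) →
               Adjℕ (toℕ a) (toℕ l) (toℕ b) (toℕ m)
  BFAdj⇒Adjℕ (inj₁ (1+l≡m , inj₁ b≡a)) = subst₂ (Adjℕ _ _) (sym b≡a) 1+l≡m up-straight
  BFAdj⇒Adjℕ (inj₁ (1+l≡m , inj₂ b≡a′)) = subst₂ (Adjℕ _ _) (sym b≡a′) 1+l≡m up-cross
  BFAdj⇒Adjℕ (inj₂ (1+m≡l , inj₁ a≡b)) = subst (λ y → Adjℕ _ _ y _) a≡b (down-straight 1+m≡l)
  BFAdj⇒Adjℕ {a} {b} {l} {m} (inj₂ (1+m≡l , inj₂ a≡b′)) =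
    subst (λ y → Adjℕ _ _ y _) a≡b (down-cross 1+m≡l)
    where
    a≡b : flipBit (toℕ a) (toℕ m) ≡ toℕ b
    a≡b = trans (cong (λ y → flipBit y (toℕ m)) a≡b′) (flipBit-involutive (toℕ b) (toℕ m))

  Adjℕ⇒BFAdj : ∀ {x i y k a b l m} → Adjℕ x i y k →
              toℕ a ≡ x → toℕ l ≡ i → toℕ b ≡ y → toℕ m ≡ k → BFAdj r (a , l) (b , m)
  Adjℕ⇒BFAdj up-straight refl refl b≡a m≡k = inj₁ (sym m≡k , inj₁ b≡a)
  Adjℕ⇒BFAdj up-cross refl refl b≡a′ m≡k = inj₁ (sym m≡k , inj₂ b≡a′)
  Adjℕ⇒BFAdj (down-straight 1+k≡i) refl l≡i b≡a m≡k =
    inj₂ (trans (cong suc m≡k) (trans 1+k≡i (sym l≡i)) , inj₁ (sym b≡a))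
  Adjℕ⇒BFAdj {k = k} {a} (down-cross 1+k≡i) refl l≡i b≡a′ m≡k =
    inj₂ (trans (cong suc m≡k) (trans 1+k≡i (sym l≡i)) ,
          inj₂ (trans (sym (flipBit-involutive (toℕ a) k)) (sym (cong₂ flipBit b≡a′ m≡k))))

  -- The bound hypotheses make (x, i) a vertex of BF(r) whenever (y, k) is one.
  colour-by : ∀ {x i y k} → x ≤ y → (k ≤ r → i ≤ r) → Coloured x i → Adjℕ x i y k →
              (∀ {y′ k′} → Adjℕ x i y′ k′ → ¬ (y′ ≡ y × k′ ≡ k) → Coloured y′ k′) →
              Coloured y k
  colour-by {x} {i} x≤y i≤r x-coloured nbr others {b} {m} refl refl =
    force (a , l) (x-coloured a≡x l≡i) (Adjℕ⇒BFAdj nbr a≡x l≡i refl refl) λ where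
      (c , n) adj c,n≢b,m →
        others (subst₂ (λ x i → Adjℕ x i _ _) a≡x l≡i (BFAdj⇒Adjℕ adj))
               (λ (c≡b , n≡m) →
                  c,n≢b,m (cong₂ _,_ (toℕ-injective c≡b) (toℕ-injective n≡m)))
               refl refl
    where
    x<2^r : x < 2 ^ r
    x<2^r = ≤-<-trans x≤y (toℕ<n b)
    i<1+r : i < suc r
    i<1+r = s≤s (i≤r (≤-pred (toℕ<n m)))
    a : Fin (2 ^ r)
    a = fromℕ< x<2^r
    a≡x : toℕ a ≡ x
    a≡x = toℕ-fromℕ< x<2^r
    l : Fin (suc r)
    l = fromℕ< i<1+r
    l≡i : toℕ l ≡ i
    l≡i = toℕ-fromℕ< i<1+r

  SmallColoured : ℕ → Set
  SmallColoured n = ∀ {x} → x mod2^ n < J (suc n) → Coloured x n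

  Sr-lower-level : ∀ {x m} → m < r → x mod2^ suc m < J (suc m) → Coloured x m
  Sr-lower-level {x} {m} m<r x%<J refl refl = init (inj₁ (m<r , _ ,
    %<⇒initial-segment x (2 ^ (m + 1)) (J (m + 1))
      (subst (λ n → x mod2^ n < J n) (+-comm 1 m) x%<J)))
    where instance _ = m^n≢0 2 (m + 1)

  Sr-top-level : SmallColoured r
  Sr-top-level {x} x%<J {a} refl l≡r = init (inj₂ (l≡r ,
    subst (λ n → toℕ a ≤ J n ∸ 1) (+-comm 1 r)
      (∸-monoˡ-≤ 1 (subst (_< J (suc r)) (m<n⇒m%n≡m (toℕ<n a)) x%<J))))
    where instance _ = m^n≢0 2 r

  small-descend : ∀ {m} → m < r → SmallColoured (suc m) → SmallColoured (suc (suc m)) →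
                  SmallColoured m
  small-descend {m} m<r small₁ small₂ {x} x%<J with bit≡0⊎bit≡1 x m
  ... | inj₁ b≡0 =
    Sr-lower-level m<r (subst (_< J (suc m)) (sym (bit≡0⇒mod2^-suc≡mod2^ x m b≡0)) x%<J)
  ... | inj₂ b≡1 =
    colour-by (bit≡1⇒flipBit≤ x m b≡1) (λ _ → m<r)
      (small₁ (<-≤-trans x′%<J (m≤m+n (J (suc m)) (2 * J m))))
      (subst (λ y → Adjℕ x′ (suc m) y m) (flipBit-involutive x m) (down-cross refl))
      others
    where
    x′ : ℕ
    x′ = flipBit x m
    x′%<J : x′ mod2^ suc m < J (suc m)
    x′%<J = subst (_< J (suc m)) (sym (bit≡1⇒flipBit-mod2^-suc x m b≡1)) x%<J
    others : ∀ {y k} → Adjℕ x′ (suc m) y k → ¬ (y ≡ x × k ≡ m) → Coloured y k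
    others up-straight _ = small₂ (mod2^<J⇒mod2^-suc<J-suc-suc x′ (suc m) x′%<J)
    others up-cross _ = small₂ (mod2^<J⇒mod2^-suc<J-suc-suc (flipBit x′ (suc m)) (suc m)
      (subst (_< J (suc m)) (sym (flipBit-mod2^ x′ (suc m))) x′%<J))
    others (down-straight refl) _ = Sr-lower-level m<r x′%<J
    others (down-cross refl) ≢x,m = ⊥-elim (≢x,m (flipBit-involutive x m , refl))

  small-below-top : ∀ k {n} → n + k ≡ r → SmallColoured n × SmallColoured (suc n)
  small-below-top zero {n} n+0≡r =
    subst SmallColoured (sym n≡r) Sr-top-level ,
    λ _ → Coloured-beyond (s≤s (≤-reflexive (sym n≡r)))
    where
    n≡r : n ≡ r
    n≡r = trans (sym (+-identityʳ n)) n+0≡r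
  small-below-top (suc k) {n} n+1+k≡r
    with small-below-top k (trans (sym (+-suc n k)) n+1+k≡r)
  ... | small₁ , small₂ = small-descend n<r small₁ small₂ , small₁
    where
    n<r : n < r
    n<r = subst (n <_) n+1+k≡r (m<m+n n z<s)

  small-coloured : ∀ n → SmallColoured n
  small-coloured n with n ≤? r
  ... | yes n≤r = proj₁ (small-below-top (r ∸ n) (m+[n∸m]≡n n≤r))
  ... | no n≰r = λ _ → Coloured-beyond (≰⇒> n≰r)

  level-suc-coloured : ∀ {m} → (∀ {k} → k ≤ m → ∀ {y} → Coloured y k) →
                       ∀ {x} → Coloured x (suc m)
  level-suc-coloured {m} below {x} with bit≡0⊎bit≡1 x m
  ... | inj₁ b≡0 = small-coloured (suc m) (bit≡0⇒mod2^-suc<J-suc-suc x m b≡0)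
  ... | inj₂ b≡1 =
    colour-by (bit≡1⇒flipBit≤ x m b≡1) (≤-trans (n≤1+n m)) (below ≤-refl)
      (subst (λ y → Adjℕ x′ m y (suc m)) (flipBit-involutive x m) up-cross)
      others
    where
    x′ : ℕ
    x′ = flipBit x m
    others : ∀ {y k} → Adjℕ x′ m y k → ¬ (y ≡ x × k ≡ suc m) → Coloured y k
    others up-straight _ = small-coloured (suc m)
      (bit≡0⇒mod2^-suc<J-suc-suc x′ m (bit≡1⇒bit-flipBit≡0 x m b≡1))
    others up-cross ≢x,1+m = ⊥-elim (≢x,1+m (flipBit-involutive x m , refl))
    others (down-straight 1+k≡m) _ = below (<⇒≤ (≤-reflexive 1+k≡m))
    others (down-cross 1+k≡m) _ = below (<⇒≤ (≤-reflexive 1+k≡m))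

  coloured-upto : ∀ i {k} → k ≤ i → ∀ {x} → Coloured x k
  coloured-upto zero z≤n {x} = small-coloured 0 (subst (_< 1) (sym (n%1≡0 x)) z<s)
  coloured-upto (suc i) k≤1+i with m≤n⇒m<n∨m≡n k≤1+i
  ... | inj₁ k<1+i = coloured-upto i (≤-pred k<1+i)
  ... | inj₂ refl = level-suc-coloured (coloured-upto i)

lemma3p4 : (r : ℕ) → 1 ≤ r → IsZeroForcing (BFAdj r) (Sr r)
lemma3p4 r _ (a , l) = Forcing.coloured-upto r (toℕ l) ≤-refl refl refl
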